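{- Let $X$ and $Y$ be disjoint posets, let $i_X:X\to\overline{X}$ and $i_Y:Y\to\overline{Y}$ be order embeddings with $\overline{X}\cap\overline{Y}=\emptyset$, and let $S\subseteq\overline{X}\times\overline{Y}$. Define $\underline{S}\subseteq X\times Y$ by $x\mathrel{\underline{S}}y\iff i_X(x)\mathrel{S}i_Y(y)$. Then: (1) if $(\overline{X},\overline{Y},S)$ is 0-coherent, then so is $(X,Y,\underline{S})$. Moreover, let $P$ be a poset and $e_X:P\to X$, $e_Y:P\to Y$ order embeddings, and set $E=(i_X\circ e_X,i_Y\circ e_Y,S)$ and $\underline{E}=(e_X,e_Y,\underline{S})$ (both extension polarities). Then: (2) for $n\in\{1,2\}$, if $E$ is $n$-coherent then so is $\underline{E}$; (3) suppose $i_X$ preserves all meets in $X$ of subsets of $e_X[P]$ that exist, and $i_Y$ preserves all joins in $Y$ of subsets of $e_Y[P]$ that exist. Then if $E$ is 3-coherent, so is $\underline{E}$; and if $E$ is a Galois polarity, so is $\underline{E}$.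
   Context: For a poset $Q$, $q^\uparrow=\{r:r\ge q\}$, $q^\downarrow=\{r:r\le q\}$. An order embedding $e:P\to Q$ is a meet-extension if $q=\bigwedge e[e^{ -1}(q^\uparrow)]$ for all $q$, and a join-extension if $q=\bigvee e[e^{ -1}(q^\downarrow)]$ for all $q$. A triple $(X,Y,R)$ with $X,Y$ disjoint posets and $R\subseteq X\times Y$ is 0-coherent if (C1),(C2) below hold. An extension polarity is a triple $(e_X,e_Y,R)$ where $P$ is a poset, $e_X:P\to X$, $e_Y:P\to Y$ order embeddings into disjoint posets, $R\subseteq X\times Y$. Conditions (variables over $X$, $Y$, $P$ as appropriate): (C1) $x_1\le_X x_2$ and $x_2\mathrel{R}y$ imply $x_1\mathrel{R}y$; (C2) $y_1\le_Y y_2$ and $x\mathrel{R}y_1$ imply $x\mathrel{R}y_2$; (C3) $e_X(p)\mathrel{R}e_Y(p)$ for all $p$; (C4) $x\mathrel{R}e_Y(p)$ and $e_X(p)\mathrel{R}y$ imply $x\mathrel{R}y$; (C5) $x_1\mathrel{R}e_Y(p)$ and $e_X(p)\le_X x_2$ imply $x_1\le_X x_2$; (C6) $y_1\le_Y e_Y(p)$ and $e_X(p)\mathrel{R}y_2$ imply $y_1\le_Y y_2$; (C7) if $T\subseteq P$, $\bigwedge e_X[T]=x$ in $X$, $x\mathrel{R}y_2$ and $y_1\le_Y e_Y(p)$ for all $p\in T$, then $y_1\le_Y y_2$; (C8) if $T\subseteq P$, $\bigvee e_Y[T]=y$ in $Y$, $x_1\mathrel{R}y$ and $e_X(q)\le_X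 x_2$ for all $q\in T$, then $x_1\le_X x_2$. The polarity is $1$-coherent if (C1)–(C4) hold, 2-coherent if (C1)–(C6), 3-coherent if (C1)–(C8). A Galois polarity is a 3-coherent extension polarity with $e_X$ a meet-extension and $e_Y$ a join-extension. -}

module Defs where

open import Level using (Level; _⊔_; suc)
open import Relation.Binary.Bundles using (Poset)
open import Relation.Unary using (Pred)
open import Data.Product using (_×_)
open import Function using (_∘_)

IsOrderEmbedding : ∀ {a₁ a₂ a₃ b₁ b₂ b₃} (A : Poset a₁ a₂ a₃) (B : Poset b₁ b₂ b₃) →
                   (Poset.Carrier A → Poset.Carrier B) → Set _
IsOrderEmbedding A B f =
  ∀ x y → (Poset._≤_ A x y → Poset._≤_ B (f x) (f y)) × (Poset._≤_ B (f x) (f y) → Poset._≤_ A x y)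

module _ {q₁ q₂ q₃} (Q : Poset q₁ q₂ q₃) where
  open Poset Q

  IsMeetOf : ∀ {i t} {I : Set i} → (I → Carrier) → Pred I t → Carrier → Set _
  IsMeetOf f T q = (∀ j → T j → q ≤ f j) × (∀ z → (∀ j → T j → z ≤ f j) → z ≤ q)

  IsJoinOf : ∀ {i t} {I : Set i} → (I → Carrier) → Pred I t → Carrier → Set _
  IsJoinOf f T q = (∀ j → T j → f j ≤ q) × (∀ z → (∀ j → T j → f j ≤ z) → q ≤ z)

IsMeetExtension : ∀ {p₁ p₂ p₃ q₁ q₂ q₃} (P : Poset p₁ p₂ p₃) (Q : Poset q₁ q₂ q₃) →
                  (Poset.Carrier P → Poset.Carrier Q) → Set _
IsMeetExtension P Q e = ∀ q → IsMeetOf Q e (λ p → Poset._≤_ Q q (e p)) q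

IsJoinExtension : ∀ {p₁ p₂ p₃ q₁ q₂ q₃} (P : Poset p₁ p₂ p₃) (Q : Poset q₁ q₂ q₃) →
                  (Poset.Carrier P → Poset.Carrier Q) → Set _
IsJoinExtension P Q e = ∀ q → IsJoinOf Q e (λ p → Poset._≤_ Q (e p) q) q

module _ {x₁ x₂ x₃ y₁ y₂ y₃ r} (X : Poset x₁ x₂ x₃) (Y : Poset y₁ y₂ y₃)
         (R : Poset.Carrier X → Poset.Carrier Y → Set r) where
  private
    module X = Poset X
    module Y = Poset Y

  C1 : Set _
  C1 = ∀ a b y → a X.≤ b → R b y → R a y

  C2 : Set _
  C2 = ∀ x a b → a Y.≤ b → R x a → R x b

  ZeroCoherent : Set _
  ZeroCoherent = C1 × C2

  module _ {p₁ p₂ p₃} (P : Poset p₁ p₂ p₃)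
           (eX : Poset.Carrier P → X.Carrier) (eY : Poset.Carrier P → Y.Carrier) where
    private module P = Poset P

    C3 : Set _
    C3 = ∀ p → R (eX p) (eY p)

    C4 : Set _
    C4 = ∀ x y p → R x (eY p) → R (eX p) y → R x y

    C5 : Set _
    C5 = ∀ a b p → R a (eY p) → eX p X.≤ b → a X.≤ b

    C6 : Set _
    C6 = ∀ a b p → a Y.≤ eY p → R (eX p) b → a Y.≤ b

    C7 : (t : Level) → Set _
    C7 t = ∀ (T : Pred P.Carrier t) x a b →
           IsMeetOf X eX T x → R x b → (∀ p → T p → a Y.≤ eY p) → a Y.≤ b

    C8 : (t : Level) → Set _
    C8 t = ∀ (T : Pred P.Carrier t) y a b →
           IsJoinOf Y eY T y → R a y → (∀ q → T q → eX q X.≤ b) → a X.≤ b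

    OneCoherent : Set _
    OneCoherent = C1 × C2 × C3 × C4

    TwoCoherent : Set _
    TwoCoherent = OneCoherent × C5 × C6

    ThreeCoherent : (t : Level) → Set _
    ThreeCoherent t = TwoCoherent × C7 t × C8 t

    GaloisPolarity : (t : Level) → Set _
    GaloisPolarity t = ThreeCoherent t × IsMeetExtension P X eX × IsJoinExtension P Y eY

PreservesMeetsOfImage : ∀ {p₁ p₂ p₃ a₁ a₂ a₃ b₁ b₂ b₃} (t : Level)
  (P : Poset p₁ p₂ p₃) (A : Poset a₁ a₂ a₃) (B : Poset b₁ b₂ b₃)
  (e : Poset.Carrier P → Poset.Carrier A) (i : Poset.Carrier A → Poset.Carrier B) → Set _
PreservesMeetsOfImage t P A B e i =
  ∀ (T : Pred (Poset.Carrier P) t) x → IsMeetOf A e T x → IsMeetOf B (i ∘ e) T (i x)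

PreservesJoinsOfImage : ∀ {p₁ p₂ p₃ a₁ a₂ a₃ b₁ b₂ b₃} (t : Level)
  (P : Poset p₁ p₂ p₃) (A : Poset a₁ a₂ a₃) (B : Poset b₁ b₂ b₃)
  (e : Poset.Carrier P → Poset.Carrier A) (i : Poset.Carrier A → Poset.Carrier B) → Set _
PreservesJoinsOfImage t P A B e i =
  ∀ (T : Pred (Poset.Carrier P) t) y → IsJoinOf A e T y → IsJoinOf B (i ∘ e) T (i y)

restrict : ∀ {a b c d r} {X : Set a} {Y : Set b} {X̄ : Set c} {Ȳ : Set d} →
           (X → X̄) → (Y → Ȳ) → (X̄ → Ȳ → Set r) → X → Y → Set r
restrict iX iY S x y = S (iX x) (iY y)

module Submission where

open import Defs
open import Level using (Level)
open import Relation.Binary.Bundles using (Poset)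
open import Data.Product using (_×_; _,_; proj₁; proj₂)
open import Function using (_∘_)

-- Every condition transfers from (iX ∘ eX, iY ∘ eY, S) to (eX, eY, S̲) by instantiating it at
-- the images under iX and iY: monotonicity of the embeddings carries the hypotheses up, and
-- order reflection carries inequalities in X̄ and Ȳ back down to X and Y. For (C7) and (C8)
-- a meet of eX[T] in X (join of eY[T] in Y) must stay a meet (join) in X̄ (Ȳ), which is
-- exactly the preservation hypothesis.

module _ {p₁ p₂ p₃ a₁ a₂ a₃ b₁ b₂ b₃}
         (P : Poset p₁ p₂ p₃) (A : Poset a₁ a₂ a₃) (B : Poset b₁ b₂ b₃)
         {e : Poset.Carrier P → Poset.Carrier A} {i : Poset.Carrier A → Poset.Carrier B}
         (emb : IsOrderEmbedding A B i) where

  private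
    up : ∀ {x y} → Poset._≤_ A x y → Poset._≤_ B (i x) (i y)
    up {x} {y} = proj₁ (emb x y)

    down : ∀ {x y} → Poset._≤_ B (i x) (i y) → Poset._≤_ A x y
    down {x} {y} = proj₂ (emb x y)

  meetExtension-reflect : IsMeetExtension P B (i ∘ e) → IsMeetExtension P A e
  meetExtension-reflect ext q =
      (λ _ q≤ep → q≤ep)
    , λ z z≤T → down (proj₂ (ext (i q)) (i z) λ p iq≤iep → up (z≤T p (down iq≤iep)))

  joinExtension-reflect : IsJoinExtension P B (i ∘ e) → IsJoinExtension P A e
  joinExtension-reflect ext q =
      (λ _ ep≤q → ep≤q)
    , λ z T≤z → down (proj₂ (ext (i q)) (i z) λ p iep≤iq → up (T≤z p (down iep≤iq)))

module Restriction
  {x₁ x₂ x₃ y₁ y₂ y₃ u₁ u₂ u₃ v₁ v₂ v₃ r}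
  (X : Poset x₁ x₂ x₃) (Y : Poset y₁ y₂ y₃) (X̄ : Poset u₁ u₂ u₃) (Ȳ : Poset v₁ v₂ v₃)
  {iX : Poset.Carrier X → Poset.Carrier X̄} (embX : IsOrderEmbedding X X̄ iX)
  {iY : Poset.Carrier Y → Poset.Carrier Ȳ} (embY : IsOrderEmbedding Y Ȳ iY)
  (S : Poset.Carrier X̄ → Poset.Carrier Ȳ → Set r)
  where

  private
    module X = Poset X
    module Y = Poset Y
    module X̄ = Poset X̄
    module Ȳ = Poset Ȳ

    upX : ∀ {a b} → a X.≤ b → iX a X̄.≤ iX b
    upX {a} {b} = proj₁ (embX a b)

    downX : ∀ {a b} → iX a X̄.≤ iX b → a X.≤ b
    downX {a} {b} = proj₂ (embX a b)

    upY : ∀ {a b} → a Y.≤ b → iY a Ȳ.≤ iY b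
    upY {a} {b} = proj₁ (embY a b)

    downY : ∀ {a b} → iY a Ȳ.≤ iY b → a Y.≤ b
    downY {a} {b} = proj₂ (embY a b)

  S̲ : X.Carrier → Y.Carrier → Set r
  S̲ = restrict iX iY S

  C1-restrict : C1 X̄ Ȳ S → C1 X Y S̲
  C1-restrict c1 a b y a≤b bSy = c1 (iX a) (iX b) (iY y) (upX a≤b) bSy

  C2-restrict : C2 X̄ Ȳ S → C2 X Y S̲
  C2-restrict c2 x a b a≤b xSa = c2 (iX x) (iY a) (iY b) (upY a≤b) xSa

  zeroCoherent-restrict : ZeroCoherent X̄ Ȳ S → ZeroCoherent X Y S̲
  zeroCoherent-restrict (c1 , c2) = C1-restrict c1 , C2-restrict c2

  module _ {p₁ p₂ p₃} (P : Poset p₁ p₂ p₃)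
           (eX : Poset.Carrier P → X.Carrier) (eY : Poset.Carrier P → Y.Carrier) where

    C4-restrict : C4 X̄ Ȳ S P (iX ∘ eX) (iY ∘ eY) → C4 X Y S̲ P eX eY
    C4-restrict c4 x y = c4 (iX x) (iY y)

    C5-restrict : C5 X̄ Ȳ S P (iX ∘ eX) (iY ∘ eY) → C5 X Y S̲ P eX eY
    C5-restrict c5 a b p aSep ep≤b = downX (c5 (iX a) (iX b) p aSep (upX ep≤b))

    C6-restrict : C6 X̄ Ȳ S P (iX ∘ eX) (iY ∘ eY) → C6 X Y S̲ P eX eY
    C6-restrict c6 a b p a≤ep epSb = downY (c6 (iY a) (iY b) p (upY a≤ep) epSb)

    C7-restrict : ∀ {t} → PreservesMeetsOfImage t P X X̄ eX iX →
                  C7 X̄ Ȳ S P (iX ∘ eX) (iY ∘ eY) t → C7 X Y S̲ P eX eY t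
    C7-restrict preserves c7 T x a b x-meet xSb a≤T =
      downY (c7 T (iX x) (iY a) (iY b) (preserves T x x-meet) xSb λ p p∈T → upY (a≤T p p∈T))

    C8-restrict : ∀ {t} → PreservesJoinsOfImage t P Y Ȳ eY iY →
                  C8 X̄ Ȳ S P (iX ∘ eX) (iY ∘ eY) t → C8 X Y S̲ P eX eY t
    C8-restrict preserves c8 T y a b y-join aSy T≤b =
      downX (c8 T (iY y) (iX a) (iX b) (preserves T y y-join) aSy λ q q∈T → upX (T≤b q q∈T))

    oneCoherent-restrict : OneCoherent X̄ Ȳ S P (iX ∘ eX) (iY ∘ eY) → OneCoherent X Y S̲ P eX eY
    oneCoherent-restrict (c1 , c2 , c3 , c4) = C1-restrict c1 , C2-restrict c2 , c3 , C4-restrict c4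

    twoCoherent-restrict : TwoCoherent X̄ Ȳ S P (iX ∘ eX) (iY ∘ eY) → TwoCoherent X Y S̲ P eX eY
    twoCoherent-restrict (c1-4 , c5 , c6) = oneCoherent-restrict c1-4 , C5-restrict c5 , C6-restrict c6

    module _ {t} (meets : PreservesMeetsOfImage t P X X̄ eX iX)
                 (joins : PreservesJoinsOfImage t P Y Ȳ eY iY) where

      threeCoherent-restrict : ThreeCoherent X̄ Ȳ S P (iX ∘ eX) (iY ∘ eY) t →
                               ThreeCoherent X Y S̲ P eX eY t
      threeCoherent-restrict (c1-6 , c7 , c8) =
        twoCoherent-restrict c1-6 , C7-restrict meets c7 , C8-restrict joins c8

      galoisPolarity-restrict : GaloisPolarity X̄ Ȳ S P (iX ∘ eX) (iY ∘ eY) t →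
                                GaloisPolarity X Y S̲ P eX eY t
      galoisPolarity-restrict (c1-8 , meetExt , joinExt) =
          threeCoherent-restrict c1-8
        , meetExtension-reflect P X X̄ embX meetExt
        , joinExtension-reflect P Y Ȳ embY joinExt

corollary6p8 : ∀ {x₁ x₂ x₃ y₁ y₂ y₃ u₁ u₂ u₃ v₁ v₂ v₃ p₁ p₂ p₃ r} (t : Level)
    (X : Poset x₁ x₂ x₃) (Y : Poset y₁ y₂ y₃)
    (X̄ : Poset u₁ u₂ u₃) (Ȳ : Poset v₁ v₂ v₃)
    (iX : Poset.Carrier X → Poset.Carrier X̄) → IsOrderEmbedding X X̄ iX →
    (iY : Poset.Carrier Y → Poset.Carrier Ȳ) → IsOrderEmbedding Y Ȳ iY →
    (S : Poset.Carrier X̄ → Poset.Carrier Ȳ → Set r) →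
    (ZeroCoherent X̄ Ȳ S → ZeroCoherent X Y (restrict iX iY S))
    × (∀ (P : Poset p₁ p₂ p₃)
         (eX : Poset.Carrier P → Poset.Carrier X) → IsOrderEmbedding P X eX →
         (eY : Poset.Carrier P → Poset.Carrier Y) → IsOrderEmbedding P Y eY →
         (OneCoherent X̄ Ȳ S P (iX ∘ eX) (iY ∘ eY) → OneCoherent X Y (restrict iX iY S) P eX eY)
         × (TwoCoherent X̄ Ȳ S P (iX ∘ eX) (iY ∘ eY) → TwoCoherent X Y (restrict iX iY S) P eX eY)
         × (PreservesMeetsOfImage t P X X̄ eX iX → PreservesJoinsOfImage t P Y Ȳ eY iY →
             (ThreeCoherent X̄ Ȳ S P (iX ∘ eX) (iY ∘ eY) t → ThreeCoherent X Y (restrict iX iY S) P eX eY t)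
             × (GaloisPolarity X̄ Ȳ S P (iX ∘ eX) (iY ∘ eY) t → GaloisPolarity X Y (restrict iX iY S) P eX eY t)))
corollary6p8 t X Y X̄ Ȳ iX embX iY embY S =
    zeroCoherent-restrict
  , λ P eX _ eY _ →
        oneCoherent-restrict P eX eY
      , twoCoherent-restrict P eX eY
      , λ meets joins → threeCoherent-restrict P eX eY meets joins
                      , galoisPolarity-restrict P eX eY meets joins
  where open Restriction X Y X̄ Ȳ embX embY S
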